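{- Let $n\geq0$, $[n]=\{1,\dots,n\}$, and let $A,B,C,D\subseteq[n]$ with $|A|=|B|$ and $|C|=|D|$. Fix $w\in S_n$ and let $Q_w$ be the set of all pairs $(u,v)\in S_n\times S_n$ with $u(C)=D$, $v(A)=B$ and $uv=w$. Then: (a) if $|w(A)\cap D|\neq|B\cap C|$, then $|Q_w|=0$; (b) if $|w(A)\cap D|=|B\cap C|$, then $|Q_w|=\omega_{B,C}$.
   Context: $S_n$ is the symmetric group on $[n]$. For $B,C\subseteq[n]$, $\omega_{B,C}:=|B\cap C|!\cdot|B\setminus C|!\cdot|C\setminus B|!\cdot|[n]\setminus(B\cup C)|!$. -}

module Defs where

open import Data.Nat using (ℕ; zero; suc; _*_; _!)
open import Data.Bool using (Bool; true)
import Data.Bool.Properties as BoolP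
open import Data.Fin using (Fin)
open import Data.Fin.Properties using (all?; any?) renaming (_≟_ to _≟ᶠ_)
open import Data.Fin.Subset using (Subset; _∩_; _─_; _∪_; ∁; ∣_∣)
open import Data.Vec using (Vec; []; _∷_; lookup; tabulate)
open import Data.Vec.Properties using (≡-dec)
open import Data.List using (List; [_]; concatMap; map; filter; cartesianProduct; length)
open import Data.List.Properties using ()
open import Data.Fin.Base using ()
open import Data.Product using (_×_; _,_)
open import Relation.Binary.PropositionalEquality using (_≡_)
open import Relation.Nullary using (Dec; does)
open import Relation.Nullary.Decidable using (_×-dec_; _→-dec_)

Fun : ℕ → Set
Fun n = Vec (Fin n) n

-- Being a permutation (element of S_n): injectivity of a self-map of the finite set [n].
IsPerm : ∀ {n} → Fun n → Set
IsPerm {n} f = ∀ (i j : Fin n) → lookup f i ≡ lookup f j → i ≡ j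

isPerm? : ∀ {n} (f : Fun n) → Dec (IsPerm f)
isPerm? f = all? λ i → all? λ j → (lookup f i ≟ᶠ lookup f j) →-dec (i ≟ᶠ j)

allVecs : ∀ {n} (k : ℕ) → List (Vec (Fin n) k)
allVecs zero = [ [] ]
allVecs {n} (suc k) = concatMap (λ i → map (i ∷_) (allVecs k)) (Data.List.allFin n)
  where import Data.List

Sym : (n : ℕ) → List (Fun n)
Sym n = filter isPerm? (allVecs n)

image : ∀ {n} → Fun n → Subset n → Subset n
image f X = tabulate λ j → does (any? λ i → (lookup X i BoolP.≟ true) ×-dec (lookup f i ≟ᶠ j))

_∘ₚ_ : ∀ {n} → Fun n → Fun n → Fun n
u ∘ₚ v = tabulate λ i → lookup u (lookup v i)

Q : ∀ {n} (A B C D : Subset n) (w : Fun n) → List (Fun n × Fun n)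
Q {n} A B C D w = filter cond (cartesianProduct (Sym n) (Sym n))
  where
  cond : (p : Fun n × Fun n) → Dec _
  cond (u , v) = ≡-dec BoolP._≟_ (image u C) D
           ×-dec (≡-dec BoolP._≟_ (image v A) B
           ×-dec ≡-dec _≟ᶠ_ (u ∘ₚ v) w)

ω : ∀ {n} → Subset n → Subset n → ℕ
ω B C = (∣ B ∩ C ∣ !) * (∣ B ─ C ∣ !) * (∣ C ─ B ∣ !) * (∣ ∁ (B ∪ C) ∣ !)

-- For permutations with u v = w, the cofactor v = u⁻¹ w is determined by u, and v(A) = B
-- becomes u(B) = w(A). So |Q_w| counts the permutations u mapping each of the four regions
-- B∩C, B∖C, C∖B, ∁(B∪C) onto the corresponding region of the pair (w(A), D). Choosing the
-- images point by point, their number is ∏ₖ tₖ(tₖ−1)⋯(tₖ−sₖ+1), with sₖ, tₖ the region sizes.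
-- Because |w(A)| = |B| and |D| = |C|, the 2×2 tables (sₖ) and (tₖ) have equal margins, so
-- they coincide exactly when |w(A)∩D| = |B∩C|; then the product is ∏ₖ sₖ! = ω_{B,C}, and
-- otherwise some tₖ < sₖ and the product vanishes.
module Submission where

open import Defs
open import Algebra.Properties.CommutativeSemigroup using (x∙yz≈y∙xz)
import Algebra.Properties.CommutativeMonoid.Sum as Sum
open import Data.Bool using (Bool; true; false; _∧_; not; if_then_else_)
import Data.Bool.Properties as Bool
open import Data.Empty using (⊥-elim)
open import Data.Fin using (Fin; zero; suc; punchIn; punchOut)
open import Data.Fin.Patterns using (0F; 1F; 2F; 3F)
open import Data.Fin.Permutation using (Permutation; permutation)
open import Data.Fin.Properties
  using (any?; suc-injective; 0≢1+n; punchOut-injective; punchInᵢ≢i; injective⇒≤)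
  renaming (_≟_ to _≟ᶠ_)
open import Data.Fin.Subset using (Subset; _∩_; _─_; _∪_; ∁; ∣_∣)
import Data.List as List
open import Data.List using (List; []; _∷_; _++_; map; concatMap; filter; length; cartesianProduct; allFin)
open import Data.Nat using (ℕ; zero; suc; _+_; _*_; _∸_; _<_; s≤s; _!)
open import Data.Nat.Properties
  using (+-assoc; *-assoc; +-identityʳ; *-identityʳ; *-zeroʳ; *-distribʳ-+; m+n∸m≡n; +-cancelˡ-≡; +-cancelˡ-<;
         +-monoˡ-<; <-irrefl; <-cmp; +-0-commutativeMonoid; *-1-commutativeMonoid; +-commutativeSemigroup)
open import Data.Nat.Solver using (module +-*-Solver)
open import Data.Product using (_×_; _,_; proj₁; proj₂; ∃)
open import Data.Product.Properties using (,-injective)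
open import Data.Vec using (Vec; []; _∷_; lookup; tabulate)
open import Data.Vec.Properties using (lookup∘tabulate; tabulate∘lookup; tabulate-cong; ≡-dec)
open import Function using (_∘_; _⇔_; mk⇔; Equivalence)
open import Relation.Binary.Definitions using (tri<; tri≈; tri>)
open import Relation.Binary.PropositionalEquality
open import Relation.Nullary using (Dec; yes; no; does; ¬_)
open import Relation.Nullary.Decidable using (dec-true; dec-false; does-⇔; _×-dec_)

open +-*-Solver using (solve; _:*_; _:=_; con)

private
  variable
    A B : Set

𝟙 : Bool → ℕ
𝟙 true  = 1
𝟙 false = 0

if-𝟙 : (b c : Bool) → (if b then 𝟙 c else 0) ≡ 𝟙 (b ∧ c)
if-𝟙 true  c = refl
if-𝟙 false c = refl

from-does : {P : Set} (P? : Dec P) → does P? ≡ true → P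
from-does (yes p) _ = p

sumBy : (A → ℕ) → List A → ℕ
sumBy f []       = 0
sumBy f (x ∷ xs) = f x + sumBy f xs

sumBy-cong : {f g : A → ℕ} → (∀ x → f x ≡ g x) → (xs : List A) → sumBy f xs ≡ sumBy g xs
sumBy-cong f≗g []       = refl
sumBy-cong f≗g (x ∷ xs) = cong₂ _+_ (f≗g x) (sumBy-cong f≗g xs)

sumBy-zero : {f : A → ℕ} → (∀ x → f x ≡ 0) → (xs : List A) → sumBy f xs ≡ 0
sumBy-zero f≗0 []       = refl
sumBy-zero f≗0 (x ∷ xs) = cong₂ _+_ (f≗0 x) (sumBy-zero f≗0 xs)

sumBy-*ʳ : (f : A → ℕ) (c : ℕ) (xs : List A) → sumBy (λ x → f x * c) xs ≡ sumBy f xs * c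
sumBy-*ʳ f c []       = refl
sumBy-*ʳ f c (x ∷ xs) = trans (cong (f x * c +_) (sumBy-*ʳ f c xs)) (sym (*-distribʳ-+ c (f x) _))

sumBy-++ : (f : A → ℕ) (xs ys : List A) → sumBy f (xs ++ ys) ≡ sumBy f xs + sumBy f ys
sumBy-++ f []       ys = refl
sumBy-++ f (x ∷ xs) ys = trans (cong (f x +_) (sumBy-++ f xs ys)) (sym (+-assoc (f x) _ _))

sumBy-map : (f : B → ℕ) (g : A → B) (xs : List A) → sumBy f (map g xs) ≡ sumBy (f ∘ g) xs
sumBy-map f g []       = refl
sumBy-map f g (x ∷ xs) = cong (f (g x) +_) (sumBy-map f g xs)

sumBy-concatMap : (f : B → ℕ) (g : A → List B) (xs : List A) →
  sumBy f (concatMap g xs) ≡ sumBy (sumBy f ∘ g) xs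
sumBy-concatMap f g []       = refl
sumBy-concatMap f g (x ∷ xs) =
  trans (sumBy-++ f (g x) (concatMap g xs)) (cong (sumBy f (g x) +_) (sumBy-concatMap f g xs))

sumBy-cartesianProduct : (f : A × B → ℕ) (xs : List A) (ys : List B) →
  sumBy f (cartesianProduct xs ys) ≡ sumBy (λ x → sumBy (λ y → f (x , y)) ys) xs
sumBy-cartesianProduct f []       ys = refl
sumBy-cartesianProduct f (x ∷ xs) ys =
  trans (sumBy-++ f (map (x ,_) ys) _) (cong₂ _+_ (sumBy-map f (x ,_) ys) (sumBy-cartesianProduct f xs ys))

sumBy-𝟙-∧ : (b : Bool) (g : A → Bool) (xs : List A) → sumBy (λ x → 𝟙 (b ∧ g x)) xs ≡ 𝟙 b * sumBy (𝟙 ∘ g) xs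
sumBy-𝟙-∧ true  g xs = sym (+-identityʳ _)
sumBy-𝟙-∧ false g xs = sumBy-zero (λ _ → refl) xs

𝟙*-cong : (b : Bool) {x y : ℕ} → (b ≡ true → x ≡ y) → 𝟙 b * x ≡ 𝟙 b * y
𝟙*-cong true  x≡y = cong (1 *_) (x≡y refl)
𝟙*-cong false x≡y = refl

sumBy-filter : {P : A → Set} (P? : ∀ x → Dec (P x)) (f : A → ℕ) (xs : List A) →
  sumBy f (filter P? xs) ≡ sumBy (λ x → if does (P? x) then f x else 0) xs
sumBy-filter P? f []       = refl
sumBy-filter P? f (x ∷ xs) with does (P? x)
... | true  = cong (f x +_) (sumBy-filter P? f xs)
... | false = sumBy-filter P? f xs

length-filter : {P : A → Set} (P? : ∀ x → Dec (P x)) (xs : List A) →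
  length (filter P? xs) ≡ sumBy (𝟙 ∘ does ∘ P?) xs
length-filter P? []       = refl
length-filter P? (x ∷ xs) with does (P? x)
... | true  = cong suc (length-filter P? xs)
... | false = length-filter P? xs

module Σ = Sum +-0-commutativeMonoid

module Π = Sum *-1-commutativeMonoid

count : ∀ {n} → (Fin n → Bool) → ℕ
count p = Σ.sum (𝟙 ∘ p)

count-cong : ∀ {n} {p q : Fin n → Bool} → (∀ x → p x ≡ q x) → count p ≡ count q
count-cong p≗q = Σ.sum-cong-≗ (cong 𝟙 ∘ p≗q)

sumBy-tabulate : ∀ {n} (f : A → ℕ) (g : Fin n → A) → sumBy f (List.tabulate g) ≡ Σ.sum (f ∘ g)
sumBy-tabulate {n = zero}  f g = refl
sumBy-tabulate {n = suc n} f g = cong (f (g zero) +_) (sumBy-tabulate f (g ∘ suc))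

sumBy-allFin : ∀ {n} (f : Fin n → ℕ) → sumBy f (allFin n) ≡ Σ.sum f
sumBy-allFin f = sumBy-tabulate f (λ x → x)

count-remove : ∀ {n} (p : Fin n → Bool) (j : Fin n) →
  count p ≡ 𝟙 (p j) + count (λ x → not (does (x ≟ᶠ j)) ∧ p x)
count-remove {suc n} p zero    = refl
count-remove {suc n} p (suc j) = begin
  𝟙 (p zero) + count (p ∘ suc)        ≡⟨ cong (𝟙 (p zero) +_) (count-remove (p ∘ suc) j) ⟩
  𝟙 (p zero) + (𝟙 (p (suc j)) + rest) ≡⟨ x∙yz≈y∙xz +-commutativeSemigroup (𝟙 (p zero)) _ rest ⟩
  𝟙 (p (suc j)) + (𝟙 (p zero) + rest) ∎
  where
  open ≡-Reasoning
  rest : ℕ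
  rest = count (λ x → not (does (x ≟ᶠ j)) ∧ p (suc x))

count-≟ : ∀ {n} (j₀ : Fin n) → count (λ j → does (j ≟ᶠ j₀)) ≡ 1
count-≟ {n} j₀ = begin
  count (λ j → does (j ≟ᶠ j₀))
    ≡⟨ count-remove _ j₀ ⟩
  𝟙 (does (j₀ ≟ᶠ j₀)) + count (λ j → not (does (j ≟ᶠ j₀)) ∧ does (j ≟ᶠ j₀))
    ≡⟨ cong₂ _+_ (cong 𝟙 (dec-true (j₀ ≟ᶠ j₀) refl))
         (trans (count-cong (λ j → Bool.∧-inverseˡ (does (j ≟ᶠ j₀)))) (Σ.sum-replicate-zero n)) ⟩
  1 ∎
  where open ≡-Reasoning

∣x∷p∣≡𝟙x+∣p∣ : ∀ {n} x (p : Subset n) → ∣ x ∷ p ∣ ≡ 𝟙 x + ∣ p ∣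
∣x∷p∣≡𝟙x+∣p∣ true  p = refl
∣x∷p∣≡𝟙x+∣p∣ false p = refl

count-lookup : ∀ {n} (p : Subset n) → count (lookup p) ≡ ∣ p ∣
count-lookup []      = refl
count-lookup (x ∷ p) = trans (cong (𝟙 x +_) (count-lookup p)) (sym (∣x∷p∣≡𝟙x+∣p∣ x p))

count-true : ∀ n → count {n} (λ _ → true) ≡ n
count-true zero    = refl
count-true (suc n) = cong suc (count-true n)

lookup-ext : ∀ {m} (v v′ : Vec A m) → (∀ i → lookup v i ≡ lookup v′ i) → v ≡ v′
lookup-ext v v′ v≗v′ = trans (sym (tabulate∘lookup v)) (trans (tabulate-cong v≗v′) (tabulate∘lookup v′))

IsInjection : ∀ {m n} → Vec (Fin n) m → Set
IsInjection {m} f = ∀ (i j : Fin m) → lookup f i ≡ lookup f j → i ≡ j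

injective⇒surjective : ∀ {n} (f : Fin n → Fin n) → (∀ i j → f i ≡ f j → i ≡ j) → ∀ y → ∃ λ x → f x ≡ y
injective⇒surjective {suc n} f inj y with any? (λ x → f x ≟ᶠ y)
... | yes hit = hit
... | no miss = ⊥-elim (<-irrefl refl (injective⇒≤ {f = squeeze} squeeze-injective))
  where
  y≢f : ∀ x → y ≢ f x
  y≢f x y≡fx = miss (x , sym y≡fx)
  squeeze : Fin (suc n) → Fin n
  squeeze x = punchOut (y≢f x)
  squeeze-injective : ∀ {x x′} → squeeze x ≡ squeeze x′ → x ≡ x′
  squeeze-injective {x} {x′} eq = inj x x′ (punchOut-injective (y≢f x) (y≢f x′) eq)

module _ {n} (w : Fun n) (w-perm : IsPerm w) where

  preimage : Fin n → Fin n
  preimage y = proj₁ (injective⇒surjective (lookup w) w-perm y)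

  lookup-preimage : ∀ y → lookup w (preimage y) ≡ y
  lookup-preimage y = proj₂ (injective⇒surjective (lookup w) w-perm y)

  count-permute : (p : Fin n → Bool) → count (p ∘ lookup w) ≡ count p
  count-permute p = sym (Σ.sum-permute (𝟙 ∘ p) π)
    where
    π : Permutation n n
    π = permutation (lookup w) preimage lookup-preimage (λ x → w-perm _ _ (lookup-preimage (lookup w x)))

lookup-∘ₚ : ∀ {n} (u v : Fun n) i → lookup (u ∘ₚ v) i ≡ lookup u (lookup v i)
lookup-∘ₚ u v = lookup∘tabulate _

lookup-image≡any : ∀ {n} (f : Fun n) (X : Subset n) (y : Fin n) →
  lookup (image f X) y ≡ does (any? λ i → (lookup X i Bool.≟ true) ×-dec (lookup f i ≟ᶠ y))
lookup-image≡any f X y = lookup∘tabulate _ y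

module _ {n} (f : Fun n) (f-perm : IsPerm f) where

  lookup-image : (X : Subset n) (i : Fin n) → lookup (image f X) (lookup f i) ≡ lookup X i
  lookup-image X i with lookup X i in X[i]
  ... | true  = trans (lookup-image≡any f X (lookup f i)) (dec-true (any? _) (i , X[i] , refl))
  ... | false = trans (lookup-image≡any f X (lookup f i)) (dec-false (any? _) not-hit)
    where
    not-hit : ¬ ∃ λ i′ → lookup X i′ ≡ true × lookup f i′ ≡ lookup f i
    not-hit (i′ , X[i′] , f[i′]≡f[i]) with () ← trans (sym X[i]) (subst (λ k → lookup X k ≡ true) (f-perm i′ i f[i′]≡f[i]) X[i′])

  image≡⇔ : (X Y : Subset n) → image f X ≡ Y ⇔ (∀ i → lookup Y (lookup f i) ≡ lookup X i)
  image≡⇔ X Y = mk⇔ (λ { refl → lookup-image X }) from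
    where
    from : (∀ i → lookup Y (lookup f i) ≡ lookup X i) → image f X ≡ Y
    from Y∘f≗X = lookup-ext (image f X) Y λ y →
      subst (λ y → lookup (image f X) y ≡ lookup Y y) (lookup-preimage f f-perm y)
        (trans (lookup-image X (preimage f f-perm y)) (sym (Y∘f≗X (preimage f f-perm y))))

∣image∣≡∣∣ : ∀ {n} (f : Fun n) → IsPerm f → (X : Subset n) → ∣ image f X ∣ ≡ ∣ X ∣
∣image∣≡∣∣ f f-perm X = begin
  ∣ image f X ∣                          ≡⟨ count-lookup (image f X) ⟨
  count (lookup (image f X))             ≡⟨ count-permute f f-perm (lookup (image f X)) ⟨
  count (lookup (image f X) ∘ lookup f)  ≡⟨ count-cong (lookup-image f f-perm X) ⟩
  count (lookup X)                       ≡⟨ count-lookup X ⟩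
  ∣ X ∣                                  ∎
  where open ≡-Reasoning

infixl 8 _↓_

_↓_ : ℕ → ℕ → ℕ
c ↓ zero  = 1
c ↓ suc s = c * (c ∸ 1) ↓ s

n↓n≡n! : ∀ n → n ↓ n ≡ n !
n↓n≡n! zero    = refl
n↓n≡n! (suc n) = cong (suc n *_) (n↓n≡n! n)

m<n⇒m↓n≡0 : ∀ {m n} → m < n → m ↓ n ≡ 0
m<n⇒m↓n≡0 {zero}  {suc n} _         = refl
m<n⇒m↓n≡0 {suc m} {suc n} (s≤s m<n) = trans (cong (suc m *_) (m<n⇒m↓n≡0 m<n)) (*-zeroʳ (suc m))

∏ : ∀ {r} → (Fin r → ℕ) → ℕ
∏ = Π.sum

∏-zero : ∀ {r} (f : Fin r → ℕ) (k : Fin r) → f k ≡ 0 → ∏ f ≡ 0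
∏-zero {suc r} f k fk≡0 = trans (Π.sum-remove {i = k} f) (cong (_* ∏ (f ∘ punchIn k)) fk≡0)

δ : ∀ {r} → Fin r → Fin r → ℕ
δ k₀ k = 𝟙 (does (k₀ ≟ᶠ k))

∏↓-extend : ∀ {r} (k₀ : Fin r) (c s : Fin r → ℕ) →
  c k₀ * ∏ (λ k → (c k ∸ δ k₀ k) ↓ s k) ≡ ∏ (λ k → c k ↓ (δ k₀ k + s k))
∏↓-extend {suc r} k₀ c s = begin
  c k₀ * ∏ F                                 ≡⟨ cong (c k₀ *_) (Π.sum-remove {i = k₀} F) ⟩
  c k₀ * (F k₀ * ∏ (F ∘ punchIn k₀))          ≡⟨ sym (*-assoc (c k₀) _ _) ⟩
  c k₀ * F k₀ * ∏ (F ∘ punchIn k₀)            ≡⟨ cong₂ _*_ extended-factor (Π.sum-cong-≗ other-factors) ⟩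
  G k₀ * ∏ (G ∘ punchIn k₀)                   ≡⟨ sym (Π.sum-remove {i = k₀} G) ⟩
  ∏ G                                        ∎
  where
  open ≡-Reasoning
  F G : Fin (suc r) → ℕ
  F k = (c k ∸ δ k₀ k) ↓ s k
  G k = c k ↓ (δ k₀ k + s k)
  extended-factor : c k₀ * F k₀ ≡ G k₀
  extended-factor rewrite dec-true (k₀ ≟ᶠ k₀) refl = refl
  other-factors : ∀ j → F (punchIn k₀ j) ≡ G (punchIn k₀ j)
  other-factors j rewrite dec-false (k₀ ≟ᶠ punchIn k₀ j) (punchInᵢ≢i k₀ j ∘ sym) = refl

∏-Fin4 : (f : Fin 4 → ℕ) → ∏ f ≡ f 0F * f 1F * f 2F * f 3F
∏-Fin4 f = solve 4 (λ a b c d → a :* (b :* (c :* (d :* con 1))) := a :* b :* c :* d) refl (f 0F) (f 1F) (f 2F) (f 3F)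

module ColouredInjections {n r : ℕ} (colour : Fin n → Fin r) where

  _without_ : (Fin n → Bool) → Fin n → Fin n → Bool
  (T without j) x = not (does (x ≟ᶠ j)) ∧ T x

  classSize : (Fin n → Bool) → Fin r → ℕ
  classSize T k = count (λ x → T x ∧ does (colour x ≟ᶠ k))

  multiplicity : ∀ {m} → (Fin m → Fin r) → Fin r → ℕ
  multiplicity a k = count (λ i → does (a i ≟ᶠ k))

  -- T holds the still unused targets; removing each chosen entry from it enforces injectivity.
  fits : ∀ {m} → (Fin n → Bool) → (Fin m → Fin r) → Vec (Fin n) m → Bool
  fits T a []      = true
  fits T a (j ∷ f) = (T j ∧ does (colour j ≟ᶠ a zero)) ∧ fits (T without j) (a ∘ suc) f

  classSize-without : ∀ T j → T j ≡ true → ∀ k → classSize (T without j) k ≡ classSize T k ∸ δ (colour j) k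
  classSize-without T j Tj k = begin
    classSize (T without j) k                  ≡⟨ count-cong (λ x → Bool.∧-assoc (not (does (x ≟ᶠ j))) (T x) _) ⟩
    count (λ x → not (does (x ≟ᶠ j)) ∧ p x)    ≡⟨ sym (m+n∸m≡n (𝟙 (p j)) _) ⟩
    𝟙 (p j) + count (λ x → not (does (x ≟ᶠ j)) ∧ p x) ∸ 𝟙 (p j) ≡⟨ cong₂ _∸_ (sym (count-remove p j)) (cong (λ b → 𝟙 (b ∧ _)) Tj) ⟩
    classSize T k ∸ δ (colour j) k              ∎
    where
    open ≡-Reasoning
    p : Fin n → Bool
    p x = T x ∧ does (colour x ≟ᶠ k)

  count-fits : ∀ m (T : Fin n → Bool) (a : Fin m → Fin r) →
    sumBy (𝟙 ∘ fits T a) (allVecs m) ≡ ∏ (λ k → classSize T k ↓ multiplicity a k)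
  count-fits zero    T a = sym (Π.sum-replicate-zero r)
  count-fits (suc m) T a = begin
    sumBy (𝟙 ∘ fits T a) (concatMap (λ j → map (j ∷_) (allVecs m)) (allFin n))
      ≡⟨ sumBy-concatMap (𝟙 ∘ fits T a) (λ j → map (j ∷_) (allVecs m)) (allFin n) ⟩
    sumBy (λ j → sumBy (𝟙 ∘ fits T a) (map (j ∷_) (allVecs m))) (allFin n)
      ≡⟨ sumBy-cong first-entry (allFin n) ⟩
    sumBy (λ j → 𝟙 (admissible j) * rest) (allFin n)
      ≡⟨ sumBy-*ʳ (𝟙 ∘ admissible) rest (allFin n) ⟩
    sumBy (𝟙 ∘ admissible) (allFin n) * rest
      ≡⟨ cong (_* rest) (sumBy-allFin (𝟙 ∘ admissible)) ⟩
    classSize T (a zero) * rest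
      ≡⟨ ∏↓-extend (a zero) (classSize T) (multiplicity (a ∘ suc)) ⟩
    ∏ (λ k → classSize T k ↓ multiplicity a k) ∎
    where
    open ≡-Reasoning
    admissible : Fin n → Bool
    admissible j = T j ∧ does (colour j ≟ᶠ a zero)
    rest : ℕ
    rest = ∏ (λ k → (classSize T k ∸ δ (a zero) k) ↓ multiplicity (a ∘ suc) k)
    remaining : ∀ j → admissible j ≡ true → ∀ k → classSize (T without j) k ≡ classSize T k ∸ δ (a zero) k
    remaining j adm k = trans (classSize-without T j (Bool.∧-conicalˡ _ _ adm) k)
      (cong (λ c → classSize T k ∸ δ c k) (from-does (colour j ≟ᶠ a zero) (Bool.∧-conicalʳ _ _ adm)))
    first-entry : ∀ j → sumBy (𝟙 ∘ fits T a) (map (j ∷_) (allVecs m)) ≡ 𝟙 (admissible j) * rest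
    first-entry j = begin
      sumBy (𝟙 ∘ fits T a) (map (j ∷_) (allVecs m))
        ≡⟨ sumBy-map (𝟙 ∘ fits T a) (j ∷_) (allVecs m) ⟩
      sumBy (λ f → 𝟙 (admissible j ∧ fits (T without j) (a ∘ suc) f)) (allVecs m)
        ≡⟨ sumBy-𝟙-∧ (admissible j) (fits (T without j) (a ∘ suc)) (allVecs m) ⟩
      𝟙 (admissible j) * sumBy (𝟙 ∘ fits (T without j) (a ∘ suc)) (allVecs m)
        ≡⟨ 𝟙*-cong (admissible j) (λ adm → trans (count-fits m (T without j) (a ∘ suc))
             (Π.sum-cong-≗ (λ k → cong (_↓ multiplicity (a ∘ suc) k) (remaining j adm k)))) ⟩
      𝟙 (admissible j) * rest ∎

  fits-sound : ∀ {m} T (a : Fin m → Fin r) (f : Vec (Fin n) m) → fits T a f ≡ true →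
    IsInjection f × (∀ i → T (lookup f i) ≡ true × colour (lookup f i) ≡ a i)
  fits-sound T a []      _   = (λ ()) , (λ ())
  fits-sound T a (j ∷ f) fit = injective , coloured
    where
    head-fits : T j ∧ does (colour j ≟ᶠ a zero) ≡ true
    head-fits = Bool.∧-conicalˡ _ _ fit
    tail-sound : IsInjection f × (∀ i → (T without j) (lookup f i) ≡ true × colour (lookup f i) ≡ a (suc i))
    tail-sound = fits-sound (T without j) (a ∘ suc) f (Bool.∧-conicalʳ _ _ fit)
    avoids-j : ∀ i → lookup f i ≢ j
    avoids-j i fi≡j
      with () ← trans (sym (cong not (dec-true (lookup f i ≟ᶠ j) fi≡j))) (Bool.∧-conicalˡ _ _ (proj₁ (proj₂ tail-sound i)))
    injective : IsInjection (j ∷ f)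
    injective zero    zero     _  = refl
    injective zero    (suc i′) eq = ⊥-elim (avoids-j i′ (sym eq))
    injective (suc i) zero     eq = ⊥-elim (avoids-j i eq)
    injective (suc i) (suc i′) eq = cong suc (proj₁ tail-sound i i′ eq)
    coloured : ∀ i → T (lookup (j ∷ f) i) ≡ true × colour (lookup (j ∷ f) i) ≡ a i
    coloured zero    = Bool.∧-conicalˡ _ _ head-fits , from-does (colour j ≟ᶠ a zero) (Bool.∧-conicalʳ _ _ head-fits)
    coloured (suc i) = Bool.∧-conicalʳ _ _ (proj₁ (proj₂ tail-sound i)) , proj₂ (proj₂ tail-sound i)

  fits-complete : ∀ {m} T (a : Fin m → Fin r) (f : Vec (Fin n) m) → IsInjection f →
    (∀ i → T (lookup f i) ≡ true) → (∀ i → colour (lookup f i) ≡ a i) → fits T a f ≡ true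
  fits-complete T a []      _         _         _        = refl
  fits-complete T a (j ∷ f) injective available coloured =
    cong₂ _∧_ (cong₂ _∧_ (available zero) (dec-true (colour j ≟ᶠ a zero) (coloured zero)))
      (fits-complete (T without j) (a ∘ suc) f (λ i i′ eq → suc-injective (injective (suc i) (suc i′) eq))
        still-available (coloured ∘ suc))
    where
    still-available : ∀ i → (T without j) (lookup f i) ≡ true
    still-available i =
      cong₂ _∧_ (cong not (dec-false (lookup f i ≟ᶠ j) (λ eq → 0≢1+n (sym (injective (suc i) zero eq))))) (available (suc i))

  everywhere : Fin n → Bool
  everywhere _ = true

  fits-everywhere⇔ : ∀ {m} (a : Fin m → Fin r) (f : Vec (Fin n) m) →
    fits everywhere a f ≡ true ⇔ (IsInjection f × ∀ i → colour (lookup f i) ≡ a i)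
  fits-everywhere⇔ a f = mk⇔
    (λ fit → let inj , col = fits-sound everywhere a f fit in inj , proj₂ ∘ col)
    (λ (inj , col) → fits-complete everywhere a f inj (λ _ → refl) col)

allVecs-count-≡ : ∀ {n} m (v₀ : Vec (Fin n) m) → sumBy (λ v → 𝟙 (does (≡-dec _≟ᶠ_ v v₀))) (allVecs m) ≡ 1
allVecs-count-≡     zero    []        = refl
allVecs-count-≡ {n} (suc m) (j₀ ∷ v₀) = begin
  sumBy is-v₀ (concatMap (λ j → map (j ∷_) (allVecs m)) (allFin n))
    ≡⟨ sumBy-concatMap is-v₀ (λ j → map (j ∷_) (allVecs m)) (allFin n) ⟩
  sumBy (λ j → sumBy is-v₀ (map (j ∷_) (allVecs m))) (allFin n)
    ≡⟨ sumBy-cong first-entry (allFin n) ⟩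
  sumBy (λ j → 𝟙 (does (j ≟ᶠ j₀))) (allFin n)
    ≡⟨ sumBy-allFin (λ j → 𝟙 (does (j ≟ᶠ j₀))) ⟩
  count (λ j → does (j ≟ᶠ j₀))
    ≡⟨ count-≟ j₀ ⟩
  1 ∎
  where
  open ≡-Reasoning
  is-v₀ : Vec (Fin n) (suc m) → ℕ
  is-v₀ v = 𝟙 (does (≡-dec _≟ᶠ_ v (j₀ ∷ v₀)))
  first-entry : ∀ j → sumBy is-v₀ (map (j ∷_) (allVecs m)) ≡ 𝟙 (does (j ≟ᶠ j₀))
  first-entry j = begin
    sumBy is-v₀ (map (j ∷_) (allVecs m))
      ≡⟨ sumBy-map is-v₀ (j ∷_) (allVecs m) ⟩
    sumBy (λ v → 𝟙 (does (j ≟ᶠ j₀) ∧ does (≡-dec _≟ᶠ_ v v₀))) (allVecs m)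
      ≡⟨ sumBy-𝟙-∧ (does (j ≟ᶠ j₀)) (λ v → does (≡-dec _≟ᶠ_ v v₀)) (allVecs m) ⟩
    𝟙 (does (j ≟ᶠ j₀)) * sumBy (λ v → 𝟙 (does (≡-dec _≟ᶠ_ v v₀))) (allVecs m)
      ≡⟨ cong (𝟙 (does (j ≟ᶠ j₀)) *_) (allVecs-count-≡ m v₀) ⟩
    𝟙 (does (j ≟ᶠ j₀)) * 1
      ≡⟨ *-identityʳ _ ⟩
    𝟙 (does (j ≟ᶠ j₀)) ∎

quadrant : Bool → Bool → Fin 4
quadrant true  true  = 0F
quadrant true  false = 1F
quadrant false true  = 2F
quadrant false false = 3F

quadrant⁻¹ : Fin 4 → Bool × Bool
quadrant⁻¹ 0F = true  , true
quadrant⁻¹ 1F = true  , false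
quadrant⁻¹ 2F = false , true
quadrant⁻¹ 3F = false , false

quadrant⁻¹∘quadrant : ∀ x y → quadrant⁻¹ (quadrant x y) ≡ (x , y)
quadrant⁻¹∘quadrant true  true  = refl
quadrant⁻¹∘quadrant true  false = refl
quadrant⁻¹∘quadrant false true  = refl
quadrant⁻¹∘quadrant false false = refl

quadrant-injective : ∀ {x y x′ y′} → quadrant x y ≡ quadrant x′ y′ → x ≡ x′ × y ≡ y′
quadrant-injective {x} {y} {x′} {y′} eq =
  ,-injective (trans (sym (quadrant⁻¹∘quadrant x y)) (trans (cong quadrant⁻¹ eq) (quadrant⁻¹∘quadrant x′ y′)))

region : ∀ {n} → Fin 4 → Subset n → Subset n → Subset n
region 0F X Y = X ∩ Y
region 1F X Y = X ─ Y
region 2F X Y = Y ─ X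
region 3F X Y = ∁ (X ∪ Y)

region-[] : ∀ k → region k [] [] ≡ []
region-[] 0F = refl
region-[] 1F = refl
region-[] 2F = refl
region-[] 3F = refl

region-∷ : ∀ {n} k x y (X Y : Subset n) → region k (x ∷ X) (y ∷ Y) ≡ does (quadrant x y ≟ᶠ k) ∷ region k X Y
region-∷ 0F true  true  X Y = refl
region-∷ 0F true  false X Y = refl
region-∷ 0F false true  X Y = refl
region-∷ 0F false false X Y = refl
region-∷ 1F true  true  X Y = refl
region-∷ 1F true  false X Y = refl
region-∷ 1F false true  X Y = refl
region-∷ 1F false false X Y = refl
region-∷ 2F true  true  X Y = refl
region-∷ 2F true  false X Y = refl
region-∷ 2F false true  X Y = refl
region-∷ 2F false false X Y = refl
region-∷ 3F true  true  X Y = refl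
region-∷ 3F true  false X Y = refl
region-∷ 3F false true  X Y = refl
region-∷ 3F false false X Y = refl

∣region∣≡count-quadrant : ∀ {n} k (X Y : Subset n) →
  ∣ region k X Y ∣ ≡ count (λ i → does (quadrant (lookup X i) (lookup Y i) ≟ᶠ k))
∣region∣≡count-quadrant k []      []      = cong ∣_∣ (region-[] k)
∣region∣≡count-quadrant k (x ∷ X) (y ∷ Y) = begin
  ∣ region k (x ∷ X) (y ∷ Y) ∣                  ≡⟨ cong ∣_∣ (region-∷ k x y X Y) ⟩
  ∣ does (quadrant x y ≟ᶠ k) ∷ region k X Y ∣    ≡⟨ ∣x∷p∣≡𝟙x+∣p∣ _ (region k X Y) ⟩
  𝟙 (does (quadrant x y ≟ᶠ k)) + ∣ region k X Y ∣ ≡⟨ cong (_ +_) (∣region∣≡count-quadrant k X Y) ⟩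
  count (λ i → does (quadrant (lookup (x ∷ X) i) (lookup (y ∷ Y) i) ≟ᶠ k)) ∎
  where open ≡-Reasoning

module Quadrants {n} (X Y : Subset n) where

  quadrantOf : Fin n → Fin 4
  quadrantOf i = quadrant (lookup X i) (lookup Y i)

  size : Fin 4 → ℕ
  size k = count (λ i → does (quadrantOf i ≟ᶠ k))

  size≡∣region∣ : ∀ k → size k ≡ ∣ region k X Y ∣
  size≡∣region∣ k = sym (∣region∣≡count-quadrant k X Y)

  indicator : Fin 4 → Fin n → ℕ
  indicator k i = 𝟙 (does (quadrantOf i ≟ᶠ k))

  size-row : size 0F + size 1F ≡ ∣ X ∣
  size-row = begin
    size 0F + size 1F                             ≡⟨ Σ.∑-distrib-+ (indicator 0F) (indicator 1F) ⟨
    Σ.sum (λ i → indicator 0F i + indicator 1F i) ≡⟨ Σ.sum-cong-≗ (λ i → pointwise (lookup X i) (lookup Y i)) ⟩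
    count (lookup X)                              ≡⟨ count-lookup X ⟩
    ∣ X ∣                                         ∎
    where
    open ≡-Reasoning
    pointwise : ∀ x y → 𝟙 (does (quadrant x y ≟ᶠ 0F)) + 𝟙 (does (quadrant x y ≟ᶠ 1F)) ≡ 𝟙 x
    pointwise true  true  = refl
    pointwise true  false = refl
    pointwise false true  = refl
    pointwise false false = refl

  size-column : size 0F + size 2F ≡ ∣ Y ∣
  size-column = begin
    size 0F + size 2F                             ≡⟨ Σ.∑-distrib-+ (indicator 0F) (indicator 2F) ⟨
    Σ.sum (λ i → indicator 0F i + indicator 2F i) ≡⟨ Σ.sum-cong-≗ (λ i → pointwise (lookup X i) (lookup Y i)) ⟩
    count (lookup Y)                              ≡⟨ count-lookup Y ⟩
    ∣ Y ∣                                         ∎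
    where
    open ≡-Reasoning
    pointwise : ∀ x y → 𝟙 (does (quadrant x y ≟ᶠ 0F)) + 𝟙 (does (quadrant x y ≟ᶠ 2F)) ≡ 𝟙 y
    pointwise true  true  = refl
    pointwise true  false = refl
    pointwise false true  = refl
    pointwise false false = refl

  size-total : size 0F + size 1F + size 2F + size 3F ≡ n
  size-total = begin
    size 0F + size 1F + size 2F + size 3F
      ≡⟨ cong (λ s → s + size 2F + size 3F) (Σ.∑-distrib-+ (indicator 0F) (indicator 1F)) ⟨
    Σ.sum (λ i → indicator 0F i + indicator 1F i) + size 2F + size 3F
      ≡⟨ cong (_+ size 3F) (Σ.∑-distrib-+ (λ i → indicator 0F i + indicator 1F i) (indicator 2F)) ⟨
    Σ.sum (λ i → indicator 0F i + indicator 1F i + indicator 2F i) + size 3F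
      ≡⟨ Σ.∑-distrib-+ (λ i → indicator 0F i + indicator 1F i + indicator 2F i) (indicator 3F) ⟨
    Σ.sum (λ i → indicator 0F i + indicator 1F i + indicator 2F i + indicator 3F i)
      ≡⟨ Σ.sum-cong-≗ (λ i → pointwise (lookup X i) (lookup Y i)) ⟩
    count {n} (λ _ → true)
      ≡⟨ count-true n ⟩
    n ∎
    where
    open ≡-Reasoning
    pointwise : ∀ x y → 𝟙 (does (quadrant x y ≟ᶠ 0F)) + 𝟙 (does (quadrant x y ≟ᶠ 1F))
                      + 𝟙 (does (quadrant x y ≟ᶠ 2F)) + 𝟙 (does (quadrant x y ≟ᶠ 3F)) ≡ 1
    pointwise true  true  = refl
    pointwise true  false = refl
    pointwise false true  = refl
    pointwise false false = refl

record SameMargins (t s : Fin 4 → ℕ) : Set where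
  field
    row    : t 0F + t 1F ≡ s 0F + s 1F
    column : t 0F + t 2F ≡ s 0F + s 2F
    total  : t 0F + t 1F + t 2F + t 3F ≡ s 0F + s 1F + s 2F + s 3F

sameMargins⇒≗ : ∀ {t s} → SameMargins t s → t 0F ≡ s 0F → ∀ k → t k ≡ s k
sameMargins⇒≗ {t} {s} margins t₀≡s₀ = pointwise
  where
  open SameMargins margins
  t₁≡s₁ : t 1F ≡ s 1F
  t₁≡s₁ = +-cancelˡ-≡ (s 0F) _ _ (trans (cong (_+ t 1F) (sym t₀≡s₀)) row)
  t₂≡s₂ : t 2F ≡ s 2F
  t₂≡s₂ = +-cancelˡ-≡ (s 0F) _ _ (trans (cong (_+ t 2F) (sym t₀≡s₀)) column)
  pointwise : ∀ k → t k ≡ s k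
  pointwise 0F = t₀≡s₀
  pointwise 1F = t₁≡s₁
  pointwise 2F = t₂≡s₂
  pointwise 3F = +-cancelˡ-≡ (s 0F + s 1F + s 2F) _ _
    (trans (cong (λ u → u + t 3F) (sym (cong₂ _+_ (cong₂ _+_ t₀≡s₀ t₁≡s₁) t₂≡s₂))) total)

sameMargins⇒deficit : ∀ {t s} → SameMargins t s → t 0F ≢ s 0F → ∃ λ k → t k < s k
sameMargins⇒deficit {t} {s} margins t₀≢s₀ with <-cmp (t 0F) (s 0F)
... | tri< t₀<s₀ _ _ = 0F , t₀<s₀
... | tri≈ _ t₀≡s₀ _ = ⊥-elim (t₀≢s₀ t₀≡s₀)
... | tri> _ _ t₀>s₀ = 2F , +-cancelˡ-< (s 0F) _ _ (subst (s 0F + t 2F <_) (SameMargins.column margins) (+-monoˡ-< (t 2F) t₀>s₀))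

module Factorisations {n} (A B C D : Subset n) (w : Fun n) (w-perm : IsPerm w) where

  W : Subset n
  W = image w A

  module Target = Quadrants W D
  module Source = Quadrants B C
  open ColouredInjections Target.quadrantOf

  ColourPreserving : Fun n → Set
  ColourPreserving u = ∀ j → Target.quadrantOf (lookup u j) ≡ Source.quadrantOf j

  IsFactorisation : Fun n → Fun n → Set
  IsFactorisation u v = image u C ≡ D × image v A ≡ B × u ∘ₚ v ≡ w

  -- Definitionally the filter condition in Q, so that length-filter applies to Q directly.
  isFactorisation? : ∀ u v → Dec (IsFactorisation u v)
  isFactorisation? u v = ≡-dec Bool._≟_ (image u C) D
                   ×-dec ≡-dec Bool._≟_ (image v A) B
                   ×-dec ≡-dec _≟ᶠ_ (u ∘ₚ v) w

  cofactor : (u : Fun n) → IsPerm u → Fun n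
  cofactor u u-perm = tabulate (preimage u u-perm ∘ lookup w)

  u∘cofactor : ∀ u u-perm i → lookup u (lookup (cofactor u u-perm) i) ≡ lookup w i
  u∘cofactor u u-perm i = trans (cong (lookup u) (lookup∘tabulate _ i)) (lookup-preimage u u-perm (lookup w i))

  -- v(A) = B and u v = w give u(B) = w(A) = W.
  factorisation⇒ : ∀ u (u-perm : IsPerm u) v → IsPerm v → IsFactorisation u v →
    ColourPreserving u × v ≡ cofactor u u-perm
  factorisation⇒ u u-perm v v-perm (uC≡D , vA≡B , u∘v≡w) = preserving , lookup-ext v (cofactor u u-perm) v≗cofactor
    where
    u∘v≗w : ∀ i → lookup u (lookup v i) ≡ lookup w i
    u∘v≗w i = trans (sym (lookup-∘ₚ u v i)) (cong (λ f → lookup f i) u∘v≡w)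
    W∘u∘v≗B∘v : ∀ i → lookup W (lookup u (lookup v i)) ≡ lookup B (lookup v i)
    W∘u∘v≗B∘v i = trans (cong (lookup W) (u∘v≗w i))
      (trans (lookup-image w w-perm A i) (sym (Equivalence.to (image≡⇔ v v-perm A B) vA≡B i)))
    preserving : ColourPreserving u
    preserving j = subst (λ j → Target.quadrantOf (lookup u j) ≡ Source.quadrantOf j) (lookup-preimage v v-perm j)
      (cong₂ quadrant (W∘u∘v≗B∘v (preimage v v-perm j)) (Equivalence.to (image≡⇔ u u-perm C D) uC≡D _))
    v≗cofactor : ∀ i → lookup v i ≡ lookup (cofactor u u-perm) i
    v≗cofactor i = u-perm _ _ (trans (u∘v≗w i) (sym (u∘cofactor u u-perm i)))

  factorisation⇐ : ∀ u (u-perm : IsPerm u) → ColourPreserving u →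
    IsPerm (cofactor u u-perm) × IsFactorisation u (cofactor u u-perm)
  factorisation⇐ u u-perm preserving =
    v-perm ,
    Equivalence.from (image≡⇔ u u-perm C D) (proj₂ ∘ quadrant-injective ∘ preserving) ,
    Equivalence.from (image≡⇔ v v-perm A B) B∘v≗A ,
    lookup-ext (u ∘ₚ v) w (λ i → trans (lookup-∘ₚ u v i) (u∘cofactor u u-perm i))
    where
    v : Fun n
    v = cofactor u u-perm
    v-perm : IsPerm v
    v-perm i i′ v[i]≡v[i′] = w-perm i i′
      (trans (sym (u∘cofactor u u-perm i)) (trans (cong (lookup u) v[i]≡v[i′]) (u∘cofactor u u-perm i′)))
    B∘v≗A : ∀ i → lookup B (lookup v i) ≡ lookup A i
    B∘v≗A i = trans (sym (proj₁ (quadrant-injective (preserving (lookup v i)))))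
      (trans (cong (lookup W) (u∘cofactor u u-perm i)) (lookup-image w w-perm A i))

  partner⇔cofactor : ∀ u (u-perm : IsPerm u) → ColourPreserving u →
    ∀ v → (IsPerm v × IsFactorisation u v) ⇔ v ≡ cofactor u u-perm
  partner⇔cofactor u u-perm preserving v = mk⇔
    (λ (v-perm , fac) → proj₂ (factorisation⇒ u u-perm v v-perm fac))
    (λ { refl → factorisation⇐ u u-perm preserving })

  partners : Fun n → ℕ
  partners u = sumBy (λ v → 𝟙 (does (isFactorisation? u v))) (Sym n)

  length-Q : length (Q A B C D w) ≡ sumBy partners (Sym n)
  length-Q = trans (length-filter _ (cartesianProduct (Sym n) (Sym n)))
    (sumBy-cartesianProduct (λ (u , v) → 𝟙 (does (isFactorisation? u v))) (Sym n) (Sym n))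

  partners-perm : ∀ u → IsPerm u → partners u ≡ 𝟙 (fits everywhere Source.quadrantOf u)
  partners-perm u u-perm = begin
    partners u
      ≡⟨ sumBy-filter isPerm? _ (allVecs n) ⟩
    sumBy (λ v → if does (isPerm? v) then 𝟙 (does (isFactorisation? u v)) else 0) (allVecs n)
      ≡⟨ sumBy-cong (λ v → if-𝟙 (does (isPerm? v)) _) (allVecs n) ⟩
    sumBy (λ v → 𝟙 (does (isPerm? v ×-dec isFactorisation? u v))) (allVecs n)
      ≡⟨ count-partners (fits everywhere Source.quadrantOf u) refl ⟩
    𝟙 (fits everywhere Source.quadrantOf u) ∎
    where
    open ≡-Reasoning
    fits⇒preserving : fits everywhere Source.quadrantOf u ≡ true → ColourPreserving u
    fits⇒preserving = proj₂ ∘ Equivalence.to (fits-everywhere⇔ Source.quadrantOf u)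
    count-partners : ∀ b → fits everywhere Source.quadrantOf u ≡ b →
      sumBy (λ v → 𝟙 (does (isPerm? v ×-dec isFactorisation? u v))) (allVecs n) ≡ 𝟙 b
    count-partners true  fit = trans
      (sumBy-cong (λ v → cong 𝟙 (does-⇔ (partner⇔cofactor u u-perm (fits⇒preserving fit) v)
                                       (isPerm? v ×-dec isFactorisation? u v) (≡-dec _≟ᶠ_ v (cofactor u u-perm))))
                  (allVecs n))
      (allVecs-count-≡ n (cofactor u u-perm))
    count-partners false unfit =
      sumBy-zero (λ v → cong 𝟙 (dec-false (isPerm? v ×-dec isFactorisation? u v) (no-partner v))) (allVecs n)
      where
      no-partner : ∀ v → ¬ (IsPerm v × IsFactorisation u v)
      no-partner v (v-perm , fac) with () ← trans (sym unfit)
        (Equivalence.from (fits-everywhere⇔ Source.quadrantOf u) (u-perm , proj₁ (factorisation⇒ u u-perm v v-perm fac)))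

  length-Q≡∏ : length (Q A B C D w) ≡ ∏ (λ k → Target.size k ↓ Source.size k)
  length-Q≡∏ = begin
    length (Q A B C D w)
      ≡⟨ length-Q ⟩
    sumBy partners (Sym n)
      ≡⟨ sumBy-filter isPerm? partners (allVecs n) ⟩
    sumBy (λ u → if does (isPerm? u) then partners u else 0) (allVecs n)
      ≡⟨ sumBy-cong (λ u → only-permutations u (isPerm? u)) (allVecs n) ⟩
    sumBy (𝟙 ∘ fits everywhere Source.quadrantOf) (allVecs n)
      ≡⟨ count-fits n everywhere Source.quadrantOf ⟩
    ∏ (λ k → Target.size k ↓ Source.size k) ∎
    where
    open ≡-Reasoning
    only-permutations : ∀ u (u-perm? : Dec (IsPerm u)) →
      (if does u-perm? then partners u else 0) ≡ 𝟙 (fits everywhere Source.quadrantOf u)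
    only-permutations u (yes u-perm) = partners-perm u u-perm
    only-permutations u (no ¬u-perm) with fits everywhere Source.quadrantOf u in fit
    ... | true  = ⊥-elim (¬u-perm (proj₁ (Equivalence.to (fits-everywhere⇔ Source.quadrantOf u) fit)))
    ... | false = refl

  margins : ∣ A ∣ ≡ ∣ B ∣ → ∣ C ∣ ≡ ∣ D ∣ → SameMargins Target.size Source.size
  margins ∣A∣≡∣B∣ ∣C∣≡∣D∣ = record
    { row    = trans Target.size-row (trans (∣image∣≡∣∣ w w-perm A) (trans ∣A∣≡∣B∣ (sym Source.size-row)))
    ; column = trans Target.size-column (trans (sym ∣C∣≡∣D∣) (sym Source.size-column))
    ; total  = trans Target.size-total (sym Source.size-total)
    }

  corner : ∣ W ∩ D ∣ ≡ ∣ B ∩ C ∣ ⇔ Target.size 0F ≡ Source.size 0F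
  corner = mk⇔ (λ eq → trans (Target.size≡∣region∣ 0F) (trans eq (sym (Source.size≡∣region∣ 0F))))
               (λ eq → trans (sym (Target.size≡∣region∣ 0F)) (trans eq (Source.size≡∣region∣ 0F)))

lemma1p2p3 : (n : ℕ) (A B C D : Subset n) → ∣ A ∣ ≡ ∣ B ∣ → ∣ C ∣ ≡ ∣ D ∣ →
    (w : Fun n) → IsPerm w →
    (∣ image w A ∩ D ∣ ≢ ∣ B ∩ C ∣ → length (Q A B C D w) ≡ 0)
    × (∣ image w A ∩ D ∣ ≡ ∣ B ∩ C ∣ → length (Q A B C D w) ≡ ω B C)
lemma1p2p3 n A B C D ∣A∣≡∣B∣ ∣C∣≡∣D∣ w w-perm = no-factorisation , factorisations
  where
  open Factorisations A B C D w w-perm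

  no-factorisation : ∣ image w A ∩ D ∣ ≢ ∣ B ∩ C ∣ → length (Q A B C D w) ≡ 0
  no-factorisation ≢ with k , deficit ← sameMargins⇒deficit (margins ∣A∣≡∣B∣ ∣C∣≡∣D∣) (≢ ∘ Equivalence.from corner) =
    trans length-Q≡∏ (∏-zero (λ k → Target.size k ↓ Source.size k) k (m<n⇒m↓n≡0 deficit))

  factorisations : ∣ image w A ∩ D ∣ ≡ ∣ B ∩ C ∣ → length (Q A B C D w) ≡ ω B C
  factorisations eq = begin
    length (Q A B C D w)                     ≡⟨ length-Q≡∏ ⟩
    ∏ (λ k → Target.size k ↓ Source.size k)  ≡⟨ Π.sum-cong-≗ (λ k → cong (_↓ Source.size k) (same-sizes k)) ⟩
    ∏ (λ k → Source.size k ↓ Source.size k)  ≡⟨ Π.sum-cong-≗ (λ k → n↓n≡n! (Source.size k)) ⟩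
    ∏ (λ k → Source.size k !)                ≡⟨ Π.sum-cong-≗ (λ k → cong _! (Source.size≡∣region∣ k)) ⟩
    ∏ (λ k → ∣ region k B C ∣ !)             ≡⟨ ∏-Fin4 (λ k → ∣ region k B C ∣ !) ⟩
    ω B C                                    ∎
    where
    open ≡-Reasoning
    same-sizes : ∀ k → Target.size k ≡ Source.size k
    same-sizes = sameMargins⇒≗ (margins ∣A∣≡∣B∣ ∣C∣≡∣D∣) (Equivalence.to corner eq)
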